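{- Let $r\geq2$ and $s\geq1$ be integers, and let $S=S(r-1,r,s)$ be the generalized spider with head $b$ and legs $X=(b,x_{1},\dots,x_{r-1})$, $Y=(b,y_{1},\dots,y_{r})$ and $Z=(b,z_{1},\dots,z_{s})$. Suppose there exists an $i_{\operatorname{bn}}$-broadcast $f$ on $S$ that covers all edges on $Z$. (i) Then $\sigma(f)=i_{\operatorname{bn}}(S)\geq\left\lceil \frac{1}{2}(r+s)\right\rceil$. (ii) If there are $f$-uncovered edges on $X$, then $\sigma(f)=i_{\operatorname{bn}}(S)\geq\left\lceil \frac{1}{2}(r+s)\right\rceil +1$.
   Context: For $k\ge3$ and $n_i\ge1$, the generalized spider $S(n_1,\dots,n_k)$ is the tree with exactly one vertex $b$ of degree $k$ (its head) such that the $k$ components of $S-b$ are paths of lengths $n_1-1,\dots,n_k-1$; the paths from $b$ to the leaves are its legs. A broadcast on a connected graph $G=(V,E)$ is a function $f:V\to\{0,1,\dots,\operatorname{diam}(G)\}$ with $f(v)\le e(v)$ (the eccentricity of $v$) for all $v$ if $|V|\ge 2$, and $f(v)=1$ if $V=\{v\}$; its cost is $\sigma(f)=\sum_v f(v)$ and $V_f^+=\{v:f(v)>0\}$. For $v\in V_f^+$, $N_f(v)=\{u:d(u,v)\le f(v)\}$ and $B_f(v)=\{u:d(u,v)=f(v)\}$. An edge $xy$ is covered by $f$ if for some $u\in V_f^+$, $x,y\in N_f(u)$ and at least one of $x,y$ is not in $B_f(u)$; otherwise it is $f$-uncovered. A broadcast is bn-independent if every vertex $x$ lying in $N_f(v)$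 for more than one $v\in V_f^+$ satisfies $d(x,u)\ge f(u)$ for all $u\in V_f^+$; it is maximal bn-independent if it is bn-independent and no bn-independent $g\ne f$ has $g\ge f$ pointwise. $i_{\operatorname{bn}}(G)$ is the minimum cost of a maximal bn-independent broadcast on $G$, and an $i_{\operatorname{bn}}$-broadcast is a maximal bn-independent broadcast of that cost. -}

module Defs where

open import Data.Nat using (ℕ; zero; suc; _+_; _≤_; _<_; _⊔_; ∣_-_∣; ⌈_/2⌉; _∸_)
open import Data.Fin using (Fin; inject₁) renaming (zero to fz; suc to fs)
open import Data.Fin.Base using (toℕ)
open import Data.List using (List; _∷_; []; map; _++_; foldr; allFin)
open import Data.Nat.ListAction using (sum)
open import Data.Bool using (Bool; true; false; if_then_else_)
open import Data.Product using (Σ; _×_; _,_; ∃)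
open import Data.Sum using (_⊎_)
open import Relation.Binary.PropositionalEquality using (_≡_)
open import Relation.Nullary using (¬_)

-- The generalized spider with three legs of lengths a, c, d:
-- head b, legs X = (b, x_1..x_a), Y = (b, y_1..y_c), Z = (b, z_1..z_d).
-- (x i) stands for x_{toℕ i + 1}, and similarly for y, z.

data Vtx (a c d : ℕ) : Set where
  b : Vtx a c d
  x : Fin a → Vtx a c d
  y : Fin c → Vtx a c d
  z : Fin d → Vtx a c d

module _ {a c d : ℕ} where

  depth : Vtx a c d → ℕ
  depth b     = 0
  depth (x i) = suc (toℕ i)
  depth (y i) = suc (toℕ i)
  depth (z i) = suc (toℕ i)

  parent : Vtx a c d → Vtx a c d
  parent b          = b
  parent (x fz)     = b
  parent (x (fs i)) = x (inject₁ i)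
  parent (y fz)     = b
  parent (y (fs i)) = y (inject₁ i)
  parent (z fz)     = b
  parent (z (fs i)) = z (inject₁ i)

  Adj : Vtx a c d → Vtx a c d → Set
  Adj u v = (Σ (u ≡ b → Data.Empty.⊥) λ _ → v ≡ parent u)
          ⊎ (Σ (v ≡ b → Data.Empty.⊥) λ _ → u ≡ parent v)
    where import Data.Empty

  sameLeg : Vtx a c d → Vtx a c d → Bool
  sameLeg (x _) (x _) = true
  sameLeg (y _) (y _) = true
  sameLeg (z _) (z _) = true
  sameLeg _     _     = false

  -- graph distance in the spider (a tree): along a leg it is the
  -- difference of depths, otherwise the path passes through the head
  dist : Vtx a c d → Vtx a c d → ℕ
  dist u v = if sameLeg u v then ∣ depth u - depth v ∣ else depth u + depth v

  allV : List (Vtx a c d)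
  allV = b ∷ (map x (allFin a) ++ map y (allFin c) ++ map z (allFin d))

  ecc : Vtx a c d → ℕ
  ecc v = foldr (λ u m → dist v u ⊔ m) 0 allV

  -- Broadcasts (the spider always has at least 2 vertices here, so the
  -- condition is f(v) ≤ e(v); this also gives f(v) ≤ diam).

  IsBroadcast : (Vtx a c d → ℕ) → Set
  IsBroadcast f = ∀ v → f v ≤ ecc v

  σ : (Vtx a c d → ℕ) → ℕ
  σ f = sum (map f allV)

  Hears : (Vtx a c d → ℕ) → Vtx a c d → Vtx a c d → Set
  Hears f v u = (0 < f v) × (dist u v ≤ f v)

  Covers : (Vtx a c d → ℕ) → Vtx a c d → Vtx a c d → Set
  Covers f u w = ∃ λ v → (0 < f v) × (dist u v ≤ f v) × (dist w v ≤ f v)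
                       × ((dist u v < f v) ⊎ (dist w v < f v))

  BnIndependent : (Vtx a c d → ℕ) → Set
  BnIndependent f =
    ∀ u → (∃ λ v₁ → ∃ λ v₂ → ¬ (v₁ ≡ v₂) × Hears f v₁ u × Hears f v₂ u)
        → ∀ w → 0 < f w → f w ≤ dist u w

  IsBnIndBroadcast : (Vtx a c d → ℕ) → Set
  IsBnIndBroadcast f = IsBroadcast f × BnIndependent f

  MaximalBnIndependent : (Vtx a c d → ℕ) → Set
  MaximalBnIndependent f =
    IsBnIndBroadcast f ×
    (∀ g → IsBnIndBroadcast g → (∀ v → f v ≤ g v) → ∀ v → g v ≡ f v)

  -- f is an i_bn-broadcast: maximal bn-independent of minimum cost
  -- (so σ f = i_bn(S))
  IsIbnBroadcast : (Vtx a c d → ℕ) → Set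
  IsIbnBroadcast f =
    MaximalBnIndependent f × (∀ g → MaximalBnIndependent g → σ f ≤ σ g)

Spider : ℕ → ℕ → Set
Spider r s = Vtx (r ∸ 1) r s

{-# OPTIONS --safe #-}
-- Every edge e–parent e of the spider is claimed by a broadcasting vertex: by one
-- covering it or, if it is uncovered, by one hearing e (maximality forces every
-- vertex to be heard, since an unheard vertex could start broadcasting). Weight the
-- edges of X and Y by 1 and those of Z by 2. A vertex v claims edges within distance
-- f v only: on its own leg at most min (depth v + f v) (2 f v + 1) of them, on another
-- leg at most f v ∸ depth v, and on Z, all of whose edges are covered, the parent end
-- must be heard as well, which leaves at most 2 f v. So v claims weight at most 4 f v,
-- and (r - 1) + r + 2 s ≤ 4 σ(f), which is (i).
-- If an edge of X is uncovered, the vertices hearing the leaves of X and Y lie on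
-- these legs and each claims weight at most 4 f - 2, gaining 4 for (ii). For a
-- strength-1 vertex next to a leaf this needs the edge above its parent to be covered;
-- otherwise its strength could be raised to 2, contradicting maximality again.

module Submission where

open import Defs
open import Data.Nat
open import Data.Nat.Properties
open import Data.Nat.Tactic.RingSolver using (solve-∀)
open import Algebra.Properties.CommutativeSemigroup +-commutativeSemigroup using (interchange)
open import Data.Fin using (Fin; toℕ; fromℕ<) renaming (zero to fz; suc to fs)
open import Data.Fin.Properties using (toℕ-injective; toℕ<n; toℕ-fromℕ<; toℕ-inject₁)
open import Data.List using (List; []; _∷_; map; _++_; tabulate; allFin; length; foldr)
open import Data.List.Properties using (map-tabulate; length-tabulate; map-++)
open import Data.List.Membership.Propositional using (_∈_)
open import Data.List.Relation.Unary.Any using (here; there; any?; satisfied)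
import Data.List.Relation.Unary.Any as Any
open import Data.List.Membership.Propositional.Properties
  using (∈-++⁺ˡ; ∈-++⁺ʳ; ∈-map⁺; ∈-allFin)
open import Data.Nat.ListAction using (sum)
open import Data.Nat.ListAction.Properties using (sum-++)
open import Data.Product using (Σ; _×_; _,_; proj₁; proj₂; ∃)
open import Data.Sum using (_⊎_; inj₁; inj₂; map₁; map₂) renaming (map to map-⊎)
open import Data.Empty using (⊥-elim)
open import Data.Bool using (Bool; true; false; if_then_else_)
open import Relation.Nullary using (¬_; Dec; yes; no)
open import Relation.Binary.Definitions using (tri<; tri≈; tri>)
open import Relation.Nullary.Decidable using (map′; _×-dec_; _⊎-dec_; _→-dec_; ¬?)
open import Relation.Binary.PropositionalEquality

module _ {A : Set} where

  sum-map-mono : {f g : A → ℕ} (ws : List A) → (∀ w → f w ≤ g w) →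
                 sum (map f ws) ≤ sum (map g ws)
  sum-map-mono []       f≤g = z≤n
  sum-map-mono (w ∷ ws) f≤g = +-mono-≤ (f≤g w) (sum-map-mono ws f≤g)

  sum-map-+ : (f g : A → ℕ) (ws : List A) →
              sum (map (λ w → f w + g w) ws) ≡ sum (map f ws) + sum (map g ws)
  sum-map-+ f g []       = refl
  sum-map-+ f g (w ∷ ws) = trans (cong (f w + g w +_) (sum-map-+ f g ws)) (interchange (f w) (g w) _ _)

  sum-map-*ˡ : (k : ℕ) (f : A → ℕ) (ws : List A) →
               sum (map (λ w → k * f w) ws) ≡ k * sum (map f ws)
  sum-map-*ˡ k f []       = sym (*-zeroʳ k)
  sum-map-*ˡ k f (w ∷ ws) = trans (cong (k * f w +_) (sum-map-*ˡ k f ws)) (sym (*-distribˡ-+ k (f w) _))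

  ∈⇒≤sum-map : (f : A → ℕ) {w : A} {ws : List A} → w ∈ ws → f w ≤ sum (map f ws)
  ∈⇒≤sum-map f (here refl) = m≤m+n _ _
  ∈⇒≤sum-map f {ws = v ∷ _} (there w∈ws) = ≤-trans (∈⇒≤sum-map f w∈ws) (m≤n+m _ (f v))

  length≤sum-map : {f : A → ℕ} (ws : List A) → (∀ w → 1 ≤ f w) → length ws ≤ sum (map f ws)
  length≤sum-map []       1≤f = z≤n
  length≤sum-map (w ∷ ws) 1≤f = +-mono-≤ (1≤f w) (length≤sum-map ws 1≤f)

  sum-map-mono-+ : {f g : A → ℕ} {k : ℕ} {w : A} {ws : List A} → w ∈ ws →
                   (∀ v → f v ≤ g v) → f w + k ≤ g w → sum (map f ws) + k ≤ sum (map g ws)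
  sum-map-mono-+ {f} {g} {k} {ws = w ∷ ws} (here refl) f≤g slack = begin
    f w + sum (map f ws) + k  ≡⟨ +-assoc (f w) _ k ⟩
    f w + (sum (map f ws) + k) ≡⟨ cong (f w +_) (+-comm _ k) ⟩
    f w + (k + sum (map f ws)) ≡⟨ +-assoc (f w) k _ ⟨
    f w + k + sum (map f ws)  ≤⟨ +-mono-≤ slack (sum-map-mono ws f≤g) ⟩
    g w + sum (map g ws)      ∎
    where open ≤-Reasoning
  sum-map-mono-+ {f} {g} {k} {ws = v ∷ ws} (there w∈ws) f≤g slack = begin
    f v + sum (map f ws) + k   ≡⟨ +-assoc (f v) _ k ⟩
    f v + (sum (map f ws) + k) ≤⟨ +-mono-≤ (f≤g v) (sum-map-mono-+ w∈ws f≤g slack) ⟩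
    g v + sum (map g ws)       ∎
    where open ≤-Reasoning

  sum-map-++ : (f : A → ℕ) (ws vs : List A) → sum (map f (ws ++ vs)) ≡ sum (map f ws) + sum (map f vs)
  sum-map-++ f ws vs = trans (cong sum (map-++ f ws vs)) (sum-++ (map f ws) (map f vs))

sum-map-swap : {A B : Set} (M : A → B → ℕ) (ws : List A) (vs : List B) →
               sum (map (λ w → sum (map (M w) vs)) ws)
               ≡ sum (map (λ v → sum (map (λ w → M w v) ws)) vs)
sum-map-swap M []       vs = sym (sum-map-zero vs)
  where
  sum-map-zero : ∀ vs → sum (map (λ _ → 0) vs) ≡ 0
  sum-map-zero []       = refl
  sum-map-zero (_ ∷ vs) = sum-map-zero vs
sum-map-swap M (w ∷ ws) vs =
  trans (cong (sum (map (M w) vs) +_) (sum-map-swap M ws vs)) (sym (sum-map-+ (M w) _ vs))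

∣m-n∣≤m+n : ∀ m n → ∣ m - n ∣ ≤ m + n
∣m-n∣≤m+n m n = ≤-trans (∣m-n∣≤m⊔n m n) (m⊔n≤m+n m n)

∣n-m∣≡1+∣1+n-m∣ : ∀ {n m} → suc n ≤ m → ∣ n - m ∣ ≡ suc ∣ suc n - m ∣
∣n-m∣≡1+∣1+n-m∣ {zero}  {suc m} _         = refl
∣n-m∣≡1+∣1+n-m∣ {suc n} {suc m} (s≤s n<m) = ∣n-m∣≡1+∣1+n-m∣ n<m

∣1+n-m∣≡1+∣n-m∣ : ∀ {n m} → m ≤ n → ∣ suc n - m ∣ ≡ suc ∣ n - m ∣
∣1+n-m∣≡1+∣n-m∣ {n}     {zero}  _         = cong suc (sym (∣-∣-identityʳ n))
∣1+n-m∣≡1+∣n-m∣ {suc n} {suc m} (s≤s m≤n) = ∣1+n-m∣≡1+∣n-m∣ m≤n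

∣m-n∣≤o⇒m≤n+o : ∀ m n {o} → ∣ m - n ∣ ≤ o → m ≤ n + o
∣m-n∣≤o⇒m≤n+o m n ∣m-n∣≤o =
  ≤-trans (m≤n+m∸n m n) (+-monoʳ-≤ n (≤-trans (m∸n≤∣m-n∣ m n) ∣m-n∣≤o))

∣m-n∣≤o⇒n∸o≤m : ∀ m n {o} → ∣ m - n ∣ ≤ o → n ∸ o ≤ m
∣m-n∣≤o⇒n∸o≤m m n {o} ∣m-n∣≤o = subst (n ∸ o ≤_) (m+n∸n≡m m o)
  (∸-monoˡ-≤ o (∣m-n∣≤o⇒m≤n+o n m (subst (_≤ o) (∣-∣-comm m n) ∣m-n∣≤o)))

∣m-n∣≡o⇒m≡n+o⊎m+o≡n : ∀ m n {o} → ∣ m - n ∣ ≡ o → m ≡ n + o ⊎ m + o ≡ n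
∣m-n∣≡o⇒m≡n+o⊎m+o≡n zero    n       eq = inj₂ (sym eq)
∣m-n∣≡o⇒m≡n+o⊎m+o≡n (suc m) zero    eq = inj₁ eq
∣m-n∣≡o⇒m≡n+o⊎m+o≡n (suc m) (suc n) eq =
  map-⊎ (cong suc) (cong suc) (∣m-n∣≡o⇒m≡n+o⊎m+o≡n m n eq)

t+k∸[t∸k]≡k+k : ∀ {k t} → k ≤ t → t + k ∸ (t ∸ k) ≡ k + k
t+k∸[t∸k]≡k+k {k} {t} k≤t = begin
  t + k ∸ (t ∸ k)               ≡⟨ cong (λ n → n + k ∸ (t ∸ k)) (m+[n∸m]≡n k≤t) ⟨
  k + (t ∸ k) + k ∸ (t ∸ k)     ≡⟨ cong (_∸ (t ∸ k)) (+-comm-middle k (t ∸ k) k) ⟩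
  k + k + (t ∸ k) ∸ (t ∸ k)     ≡⟨ m+n∸n≡m (k + k) (t ∸ k) ⟩
  k + k                         ∎
  where
  open ≡-Reasoning
  +-comm-middle : ∀ m n o → m + n + o ≡ m + o + n
  +-comm-middle = solve-∀

1+k+k≤4k : ∀ {k} → 1 ≤ k → suc (k + k) ≤ 4 * k
1+k+k≤4k {suc j} _ = subst (suc (suc j + suc j) ≤_) (identity j) (m≤m+n _ (1 + 2 * j))
  where
  identity : ∀ j → suc (suc j + suc j) + (1 + 2 * j) ≡ 4 * suc j
  identity = solve-∀

3+k+k≤4k : ∀ {k} → 2 ≤ k → suc (k + k) + 2 ≤ 4 * k
3+k+k≤4k {suc (suc j)} (s≤s (s≤s z≤n)) =
  subst (suc (suc (suc j) + suc (suc j)) + 2 ≤_) (identity j) (m≤m+n _ (1 + 2 * j))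
  where
  identity : ∀ j → suc (suc (suc j) + suc (suc j)) + 2 + (1 + 2 * j) ≡ 4 * suc (suc j)
  identity = solve-∀

⌈n/2⌉≤m : ∀ {n m} → 2 * n ≤ suc (4 * m) → ⌈ n /2⌉ ≤ m
⌈n/2⌉≤m {n} {m} 2n≤ = subst (⌈ n /2⌉ ≤_) (sym (n≡⌈n+n/2⌉ m)) (⌈n/2⌉-mono n≤m+m)
  where
  n≤m+m : n ≤ m + m
  n≤m+m with n ≤? m + m
  ... | yes n≤ = n≤
  ... | no n≰ = ⊥-elim (1+n≰n (begin
    suc (suc (4 * m))       ≡⟨ identity m ⟩
    2 * suc (m + m)         ≤⟨ *-monoʳ-≤ 2 (≰⇒> n≰) ⟩
    2 * n                   ≤⟨ 2n≤ ⟩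
    suc (4 * m)             ∎))
    where
    open ≤-Reasoning
    identity : ∀ m → suc (suc (4 * m)) ≡ 2 * suc (m + m)
    identity = solve-∀

module _ {t k o p q : ℕ} (t≤k : t ≤ k) where

  private
    e : ℕ
    e = k ∸ t

    k≡t+e : k ≡ t + e
    k≡t+e = sym (m+[n∸m]≡n t≤k)

  arm-weight-arith : o ≤ t + k → p ≤ k ∸ t → q ≤ k ∸ t → o + p + 2 * q + 2 * t ≤ 4 * k
  arm-weight-arith o≤ p≤ q≤ = begin
    o + p + 2 * q + 2 * t
      ≤⟨ +-monoˡ-≤ (2 * t) (+-mono-≤ (+-mono-≤ o≤ p≤) (*-monoʳ-≤ 2 q≤)) ⟩
    t + k + e + 2 * e + 2 * t        ≡⟨ cong (λ n → t + n + e + 2 * e + 2 * t) k≡t+e ⟩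
    t + (t + e) + e + 2 * e + 2 * t  ≡⟨ identity t e ⟩
    4 * (t + e)                      ≡⟨ cong (4 *_) k≡t+e ⟨
    4 * k                            ∎
    where
    open ≤-Reasoning
    identity : ∀ t e → t + (t + e) + e + 2 * e + 2 * t ≡ 4 * (t + e)
    identity = solve-∀

  z-weight-arith : p ≤ k ∸ t → o ≤ k ∸ t → q ≤ t + k → p + o + 2 * q ≤ 4 * k
  z-weight-arith p≤ o≤ q≤ = begin
    p + o + 2 * q                           ≤⟨ +-mono-≤ (+-mono-≤ p≤ o≤) (*-monoʳ-≤ 2 q≤) ⟩
    e + e + 2 * (t + k)                     ≡⟨ cong (λ n → e + e + 2 * (t + n)) k≡t+e ⟩
    e + e + 2 * (t + (t + e))               ≡⟨ identity t e ⟩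
    4 * (t + e)                             ≡⟨ cong (4 *_) k≡t+e ⟨
    4 * k                                   ∎
    where
    open ≤-Reasoning
    identity : ∀ t e → e + e + 2 * (t + (t + e)) ≡ 4 * (t + e)
    identity = solve-∀

indicator : {P : Set} → Dec P → ℕ
indicator (yes _) = 1
indicator (no _)  = 0

indicator≤1 : {P : Set} (P? : Dec P) → indicator P? ≤ 1
indicator≤1 (yes _) = s≤s z≤n
indicator≤1 (no _)  = z≤n

indicator-yes : {P : Set} (P? : Dec P) → P → indicator P? ≡ 1
indicator-yes (yes _) _ = refl
indicator-yes (no ¬p) p = ⊥-elim (¬p p)

indicator-pos : {P : Set} (P? : Dec P) → 0 < indicator P? → P
indicator-pos (yes p) _ = p

count-window-tabulate : ∀ n (F : Fin n → ℕ) (o lo hi : ℕ) → (∀ i → F i ≤ 1) →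
                        (∀ i → 0 < F i → lo ≤ toℕ i + o × toℕ i + o ≤ hi) →
                        sum (tabulate F) ≤ suc hi ∸ (lo ⊔ o)
count-window-tabulate zero    F o lo hi F≤1 window = z≤n
count-window-tabulate (suc n) F o lo hi F≤1 window with F fz | F≤1 fz | window fz
  | count-window-tabulate n (λ i → F (fs i)) (suc o) lo hi (λ i → F≤1 (fs i))
      (λ i p → subst (λ k → lo ≤ k × k ≤ hi) (sym (+-suc (toℕ i) o)) (window (fs i) p))
... | zero        | _      | _     | ih = ≤-trans ih (∸-monoʳ-≤ (suc hi) (⊔-monoʳ-≤ lo (n≤1+n o)))
... | suc (suc _) | s≤s () | _     | _
... | suc zero    | _      | inWin | ih with inWin (s≤s z≤n)
...   | lo≤o , o≤hi
  rewrite m≤n⇒m⊔n≡n lo≤o | m≤n⇒m⊔n≡n (≤-trans lo≤o (n≤1+n o)) =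
  ≤-trans (s≤s ih) (≤-reflexive (sym (+-∸-assoc 1 o≤hi)))

count-window : ∀ {n} {P : Fin n → Set} (P? : ∀ i → Dec (P i)) {lo hi : ℕ} → 1 ≤ lo →
               (∀ i → P i → lo ≤ suc (toℕ i) × suc (toℕ i) ≤ hi) →
               sum (map (λ i → indicator (P? i)) (allFin n)) ≤ suc hi ∸ lo
count-window {n} P? {lo} {hi} 1≤lo window =
  subst (_≤ suc hi ∸ lo) (cong sum (sym (map-tabulate (λ i → i) F)))
    (subst (λ k → sum (tabulate F) ≤ suc hi ∸ k) (m≥n⇒m⊔n≡m 1≤lo)
      (count-window-tabulate n F 1 lo hi (λ i → indicator≤1 (P? i))
        (λ i p → subst (λ k → lo ≤ k × k ≤ hi) (+-comm 1 (toℕ i))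
                         (window i (indicator-pos (P? i) p)))))
  where
  F : Fin n → ℕ
  F i = indicator (P? i)

-- Distances in the spider

data Leg : Set where
  X Y Z : Leg

_≟Leg_ : (L M : Leg) → Dec (L ≡ M)
X ≟Leg X = yes refl
X ≟Leg Y = no λ ()
X ≟Leg Z = no λ ()
Y ≟Leg X = no λ ()
Y ≟Leg Y = yes refl
Y ≟Leg Z = no λ ()
Z ≟Leg X = no λ ()
Z ≟Leg Y = no λ ()
Z ≟Leg Z = yes refl

sameLeg? : Leg → Leg → Bool
sameLeg? X X = true
sameLeg? Y Y = true
sameLeg? Z Z = true
sameLeg? _ _ = false

legDist : Leg → ℕ → Leg → ℕ → ℕ
legDist L n M m = if sameLeg? L M then ∣ n - m ∣ else n + m

legDist-same : ∀ L n m → legDist L n L m ≡ ∣ n - m ∣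
legDist-same X n m = refl
legDist-same Y n m = refl
legDist-same Z n m = refl

legDist-other : ∀ {L M} n m → L ≢ M → legDist L n M m ≡ n + m
legDist-other {X} {X} n m L≢M = ⊥-elim (L≢M refl)
legDist-other {X} {Y} n m L≢M = refl
legDist-other {X} {Z} n m L≢M = refl
legDist-other {Y} {X} n m L≢M = refl
legDist-other {Y} {Y} n m L≢M = ⊥-elim (L≢M refl)
legDist-other {Y} {Z} n m L≢M = refl
legDist-other {Z} {X} n m L≢M = refl
legDist-other {Z} {Y} n m L≢M = refl
legDist-other {Z} {Z} n m L≢M = ⊥-elim (L≢M refl)

legDist-cases : ∀ L M n m → (L ≡ M × legDist L n M m ≡ ∣ n - m ∣)
                          ⊎ (L ≢ M × legDist L n M m ≡ n + m)
legDist-cases L M n m with L ≟Leg M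
... | yes refl = inj₁ (refl , legDist-same L n m)
... | no L≢M   = inj₂ (L≢M , legDist-other n m L≢M)

legDist≤+ : ∀ L M n m → legDist L n M m ≤ n + m
legDist≤+ L M n m with legDist-cases L M n m
... | inj₁ (_ , eq) = ≤-trans (≤-reflexive eq) (∣m-n∣≤m+n n m)
... | inj₂ (_ , eq) = ≤-reflexive eq

legDist-zeroˡ : ∀ L M m → legDist L 0 M m ≡ m
legDist-zeroˡ L M m with legDist-cases L M 0 m
... | inj₁ (_ , eq) = eq
... | inj₂ (_ , eq) = eq

legDist-zeroʳ : ∀ L M n → legDist L n M 0 ≡ n
legDist-zeroʳ L M n with legDist-cases L M n 0
... | inj₁ (_ , eq) = trans eq (∣-∣-identityʳ n)
... | inj₂ (_ , eq) = trans eq (+-identityʳ n)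

legDist-sym : ∀ L M n m → legDist L n M m ≡ legDist M m L n
legDist-sym L M n m with legDist-cases L M n m | legDist-cases M L m n
... | inj₁ (_ , eq)    | inj₁ (_ , eq′)    = trans eq (trans (∣-∣-comm n m) (sym eq′))
... | inj₁ (refl , _)  | inj₂ (M≢L , _)   = ⊥-elim (M≢L refl)
... | inj₂ (L≢M , _)   | inj₁ (refl , _)  = ⊥-elim (L≢M refl)
... | inj₂ (_ , eq)    | inj₂ (_ , eq′)    = trans eq (trans (+-comm n m) (sym eq′))

legDist-triangle : ∀ L N M n p m → legDist L n M m ≤ legDist L n N p + legDist N p M m
legDist-triangle L N M n p m with legDist-cases L M n m | legDist-cases L N n p | legDist-cases N M p m
... | inj₁ (refl , e) | inj₁ (refl , e₁) | inj₁ (_ , e₂) rewrite e | e₁ | e₂ = ∣-∣-triangle n p m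
... | inj₁ (refl , _) | inj₁ (refl , _)  | inj₂ (N≢M , _) = ⊥-elim (N≢M refl)
... | inj₁ (refl , _) | inj₂ (L≢N , _)   | inj₁ (refl , _) = ⊥-elim (L≢N refl)
... | inj₁ (refl , e) | inj₂ (_ , e₁)    | inj₂ (_ , e₂) rewrite e | e₁ | e₂ =
  ≤-trans (∣m-n∣≤m+n n m) (+-mono-≤ (m≤m+n n p) (m≤n+m m p))
... | inj₂ (L≢M , _)  | inj₁ (refl , _)  | inj₁ (refl , _) = ⊥-elim (L≢M refl)
... | inj₂ (_ , e)    | inj₁ (refl , e₁) | inj₂ (_ , e₂) rewrite e | e₁ | e₂ =
  ≤-trans (+-monoˡ-≤ m (m≤∣m-n∣+n n p)) (≤-reflexive (+-assoc ∣ n - p ∣ p m))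
... | inj₂ (_ , e)    | inj₂ (_ , e₁)    | inj₁ (refl , e₂) rewrite e | e₁ | e₂ =
  ≤-trans (+-monoʳ-≤ n (≤-trans (m≤∣m-n∣+n m p) (≤-reflexive (trans (cong (_+ p) (∣-∣-comm m p))
                                                                    (+-comm ∣ p - m ∣ p)))))
          (≤-reflexive (sym (+-assoc n p ∣ p - m ∣)))
... | inj₂ (_ , e)    | inj₂ (_ , e₁)    | inj₂ (_ , e₂) rewrite e | e₁ | e₂ =
  +-mono-≤ (m≤m+n n p) (m≤n+m m p)

module _ {a c d : ℕ} where

  private
    V : Set
    V = Vtx a c d

  legLength : Leg → ℕ
  legLength X = a
  legLength Y = c
  legLength Z = d

  vertex : (L : Leg) → Fin (legLength L) → V
  vertex X i = x i
  vertex Y i = y i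
  vertex Z i = z i

  -- The head is put on leg X; at depth 0 the leg never matters.
  legOf : V → Leg
  legOf b     = X
  legOf (x _) = X
  legOf (y _) = Y
  legOf (z _) = Z

  legOf-vertex : ∀ L i → legOf (vertex L i) ≡ L
  legOf-vertex X i = refl
  legOf-vertex Y i = refl
  legOf-vertex Z i = refl

  depth-vertex : ∀ L i → depth (vertex L i) ≡ suc (toℕ i)
  depth-vertex X i = refl
  depth-vertex Y i = refl
  depth-vertex Z i = refl

  dist≡legDist : ∀ u v → dist u v ≡ legDist (legOf u) (depth u) (legOf v) (depth v)
  dist≡legDist b     b     = refl
  dist≡legDist b     (x _) = refl
  dist≡legDist b     (y _) = refl
  dist≡legDist b     (z _) = refl
  dist≡legDist (x _) b     = +-identityʳ _
  dist≡legDist (x _) (x _) = refl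
  dist≡legDist (x _) (y _) = refl
  dist≡legDist (x _) (z _) = refl
  dist≡legDist (y _) b     = refl
  dist≡legDist (y _) (x _) = refl
  dist≡legDist (y _) (y _) = refl
  dist≡legDist (y _) (z _) = refl
  dist≡legDist (z _) b     = refl
  dist≡legDist (z _) (x _) = refl
  dist≡legDist (z _) (y _) = refl
  dist≡legDist (z _) (z _) = refl

  dist-sym : ∀ u v → dist u v ≡ dist v u
  dist-sym u v = trans (dist≡legDist u v)
    (trans (legDist-sym (legOf u) (legOf v) (depth u) (depth v)) (sym (dist≡legDist v u)))

  dist-triangle : ∀ u v w → dist u w ≤ dist u v + dist v w
  dist-triangle u v w rewrite dist≡legDist u w | dist≡legDist u v | dist≡legDist v w =
    legDist-triangle (legOf u) (legOf v) (legOf w) (depth u) (depth v) (depth w)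

  dist≤depth+depth : ∀ u v → dist u v ≤ depth u + depth v
  dist≤depth+depth u v rewrite dist≡legDist u v = legDist≤+ (legOf u) (legOf v) (depth u) (depth v)

  dist-head : ∀ u → dist u b ≡ depth u
  dist-head u = trans (dist≡legDist u b) (legDist-zeroʳ (legOf u) X (depth u))

  vertex-ext : ∀ u v → depth u ≡ depth v → (depth u ≡ 0 ⊎ legOf u ≡ legOf v) → u ≡ v
  vertex-ext b     b     _  _         = refl
  vertex-ext (x i) (x j) eq _         = cong x (toℕ-injective (suc-injective eq))
  vertex-ext (y i) (y j) eq _         = cong y (toℕ-injective (suc-injective eq))
  vertex-ext (z i) (z j) eq _         = cong z (toℕ-injective (suc-injective eq))
  vertex-ext b     (x _) () _
  vertex-ext b     (y _) () _
  vertex-ext b     (z _) () _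
  vertex-ext (x _) b     () _
  vertex-ext (y _) b     () _
  vertex-ext (z _) b     () _
  vertex-ext (x _) (y _) _  (inj₂ ())
  vertex-ext (x _) (z _) _  (inj₂ ())
  vertex-ext (y _) (x _) _  (inj₂ ())
  vertex-ext (y _) (z _) _  (inj₂ ())
  vertex-ext (z _) (x _) _  (inj₂ ())
  vertex-ext (z _) (y _) _  (inj₂ ())

  dist≡0⇒≡ : ∀ u v → dist u v ≡ 0 → u ≡ v
  dist≡0⇒≡ u v eq with legDist-cases (legOf u) (legOf v) (depth u) (depth v)
  ... | inj₁ (same , eq′) =
    vertex-ext u v (∣m-n∣≡0⇒m≡n (trans (sym eq′) (trans (sym (dist≡legDist u v)) eq))) (inj₂ same)
  ... | inj₂ (_ , eq′) = vertex-ext u v (trans u₀ (sym v₀)) (inj₁ u₀)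
    where
    sum≡0 : depth u + depth v ≡ 0
    sum≡0 = trans (sym eq′) (trans (sym (dist≡legDist u v)) eq)
    u₀ = m+n≡0⇒m≡0 (depth u) sum≡0
    v₀ = m+n≡0⇒n≡0 (depth u) sum≡0

  legLengthOf : V → ℕ
  legLengthOf u = legLength (legOf u)

  depth≤legLength : ∀ u → depth u ≤ legLengthOf u
  depth≤legLength b     = z≤n
  depth≤legLength (x i) = toℕ<n i
  depth≤legLength (y i) = toℕ<n i
  depth≤legLength (z i) = toℕ<n i

  depth-parent : (u : V) → depth (parent u) ≡ pred (depth u)
  depth-parent b          = refl
  depth-parent (x fz)     = refl
  depth-parent (x (fs i)) = cong suc (toℕ-inject₁ i)
  depth-parent (y fz)     = refl
  depth-parent (y (fs i)) = cong suc (toℕ-inject₁ i)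
  depth-parent (z fz)     = refl
  depth-parent (z (fs i)) = cong suc (toℕ-inject₁ i)

  legOf-parent : ∀ u → depth (parent u) ≡ 0 ⊎ legOf (parent u) ≡ legOf u
  legOf-parent b          = inj₁ refl
  legOf-parent (x fz)     = inj₁ refl
  legOf-parent (x (fs i)) = inj₂ refl
  legOf-parent (y fz)     = inj₁ refl
  legOf-parent (y (fs i)) = inj₂ refl
  legOf-parent (z fz)     = inj₁ refl
  legOf-parent (z (fs i)) = inj₂ refl

  legOf-parent-deep : (u : V) → 2 ≤ depth u → legOf (parent u) ≡ legOf u
  legOf-parent-deep u 2≤depth with legOf-parent u
  ... | inj₁ atHead  = ⊥-elim (<⇒≢ (∸-monoˡ-≤ 1 2≤depth) (sym (trans (sym (depth-parent u)) atHead)))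
  ... | inj₂ sameLeg = sameLeg

  dist-parent : ∀ u v → dist (parent u) v ≡ legDist (legOf u) (pred (depth u)) (legOf v) (depth v)
  dist-parent u v with legOf-parent u
  ... | inj₂ sameLeg rewrite dist≡legDist (parent u) v | sameLeg | depth-parent u = refl
  ... | inj₁ atHead = begin
    dist (parent u) v
      ≡⟨ dist≡legDist (parent u) v ⟩
    legDist (legOf (parent u)) (depth (parent u)) (legOf v) (depth v)
      ≡⟨ cong (λ n → legDist (legOf (parent u)) n (legOf v) (depth v)) atHead ⟩
    legDist (legOf (parent u)) 0 (legOf v) (depth v)
      ≡⟨ legDist-zeroˡ _ _ _ ⟩
    depth v
      ≡⟨ legDist-zeroˡ _ _ _ ⟨
    legDist (legOf u) 0 (legOf v) (depth v)
      ≡⟨ cong (λ n → legDist (legOf u) n (legOf v) (depth v)) (trans (sym (depth-parent u)) atHead) ⟨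
    legDist (legOf u) (pred (depth u)) (legOf v) (depth v) ∎
    where open ≡-Reasoning

  dist-sameLeg : ∀ u v → legOf u ≡ legOf v → dist u v ≡ ∣ depth u - depth v ∣
  dist-sameLeg u v same = begin
    dist u v                                         ≡⟨ dist≡legDist u v ⟩
    legDist (legOf u) (depth u) (legOf v) (depth v)
      ≡⟨ cong (λ L → legDist L (depth u) (legOf v) (depth v)) same ⟩
    legDist (legOf v) (depth u) (legOf v) (depth v)  ≡⟨ legDist-same (legOf v) (depth u) (depth v) ⟩
    ∣ depth u - depth v ∣                            ∎
    where open ≡-Reasoning

  dist-refl : ∀ u → dist u u ≡ 0
  dist-refl u = trans (dist-sameLeg u u refl) (∣n-n∣≡0 (depth u))

  dist-parent-sameLeg : ∀ u v → legOf u ≡ legOf v → dist (parent u) v ≡ ∣ pred (depth u) - depth v ∣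
  dist-parent-sameLeg u v same = begin
    dist (parent u) v                                       ≡⟨ dist-parent u v ⟩
    legDist (legOf u) (pred (depth u)) (legOf v) (depth v)
      ≡⟨ cong (λ L → legDist L (pred (depth u)) (legOf v) (depth v)) same ⟩
    legDist (legOf v) (pred (depth u)) (legOf v) (depth v)
      ≡⟨ legDist-same (legOf v) (pred (depth u)) (depth v) ⟩
    ∣ pred (depth u) - depth v ∣                            ∎
    where open ≡-Reasoning

  dist-parent-self : (u : V) → 1 ≤ depth u → dist (parent u) u ≡ 1
  dist-parent-self u 1≤depth = trans (dist-parent-sameLeg u u refl) (∣pred-n-n∣≡1 1≤depth)
    where
    ∣pred-n-n∣≡1 : ∀ {n} → 1 ≤ n → ∣ pred n - n ∣ ≡ 1
    ∣pred-n-n∣≡1 {suc n} _ = trans (cong (∣ n -_∣) (+-comm 1 n)) (∣m-m+n∣≡n n 1)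

  dist-vertex-sameLeg : ∀ {L v} i → legOf v ≡ L → dist (vertex L i) v ≡ ∣ suc (toℕ i) - depth v ∣
  dist-vertex-sameLeg {L} {v} i onLeg =
    trans (dist-sameLeg (vertex L i) v (trans (legOf-vertex L i) (sym onLeg)))
          (cong (λ n → ∣ n - depth v ∣) (depth-vertex L i))

  dist-parent-vertex-sameLeg : ∀ {L v} i → legOf v ≡ L → dist (parent (vertex L i)) v ≡ ∣ toℕ i - depth v ∣
  dist-parent-vertex-sameLeg {L} {v} i onLeg =
    trans (dist-parent-sameLeg (vertex L i) v (trans (legOf-vertex L i) (sym onLeg)))
          (cong (λ n → ∣ pred n - depth v ∣) (depth-vertex L i))

  dist-otherLeg : ∀ u v → legOf v ≢ legOf u ⊎ depth v ≡ 0 → dist u v ≡ depth u + depth v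
  dist-otherLeg u v (inj₁ otherLeg) =
    trans (dist≡legDist u v) (legDist-other (depth u) (depth v) (λ u≡ → otherLeg (sym u≡)))
  dist-otherLeg u v (inj₂ atHead) = begin
    dist u v                                    ≡⟨ dist≡legDist u v ⟩
    legDist (legOf u) (depth u) (legOf v) (depth v) ≡⟨ cong (legDist (legOf u) (depth u) (legOf v)) atHead ⟩
    legDist (legOf u) (depth u) (legOf v) 0     ≡⟨ legDist-zeroʳ (legOf u) (legOf v) (depth u) ⟩
    depth u                                     ≡⟨ +-identityʳ (depth u) ⟨
    depth u + 0                                 ≡⟨ cong (depth u +_) atHead ⟨
    depth u + depth v                           ∎
    where open ≡-Reasoning

  dist-vertex-otherLeg : ∀ {L v} i → legOf v ≢ L ⊎ depth v ≡ 0 → dist (vertex L i) v ≡ suc (toℕ i) + depth v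
  dist-vertex-otherLeg {L} {v} i offLeg = trans
    (dist-otherLeg (vertex L i) v (map₁ (subst (legOf v ≢_) (sym (legOf-vertex L i))) offLeg))
    (cong (_+ depth v) (depth-vertex L i))

  ≡parent : ∀ p (q : V) → suc (depth p) ≡ depth q → depth p ≡ 0 ⊎ legOf p ≡ legOf q → p ≡ parent q
  ≡parent p q depth≡ leg≡ = vertex-ext p (parent q) depth-p≡ leg-p≡
    where
    depth-p≡ : depth p ≡ depth (parent q)
    depth-p≡ = trans (cong pred depth≡) (sym (depth-parent q))
    leg-p≡ : depth p ≡ 0 ⊎ legOf p ≡ legOf (parent q)
    leg-p≡ with legOf-parent q
    ... | inj₁ pq-atHead = inj₁ (trans depth-p≡ pq-atHead)
    ... | inj₂ pq∈L      = map₂ (λ p∈L → trans p∈L (sym pq∈L)) leg≡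

  dist≡⇒ancestor⊎descendant : ∀ p q {n} → n ≤ depth q → dist p q ≡ n →
                               (depth p + n ≡ depth q × (depth p ≡ 0 ⊎ legOf p ≡ legOf q))
                             ⊎ (legOf p ≡ legOf q × depth p ≡ depth q + n)
  dist≡⇒ancestor⊎descendant p q {n} n≤depth eq
    with legDist-cases (legOf p) (legOf q) (depth p) (depth q)
  ... | inj₁ (same , eq′)
    with ∣m-n∣≡o⇒m≡n+o⊎m+o≡n (depth p) (depth q) (trans (sym eq′) (trans (sym (dist≡legDist p q)) eq))
  ...   | inj₁ below = inj₂ (same , below)
  ...   | inj₂ above = inj₁ (above , inj₂ same)
  dist≡⇒ancestor⊎descendant p q {n} n≤depth eq | inj₂ (_ , eq′) =
    inj₁ (trans (cong (_+ n) p-atHead) (trans (sym sum≡n) (cong (_+ depth q) p-atHead)) , inj₁ p-atHead)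
    where
    sum≡n : depth p + depth q ≡ n
    sum≡n = trans (sym eq′) (trans (sym (dist≡legDist p q)) eq)
    p-atHead : depth p ≡ 0
    p-atHead = n≤0⇒n≡0 (+-cancelʳ-≤ (depth q) (depth p) 0 (subst (_≤ depth q) (sym sum≡n) n≤depth))

  InSubtree : V → V → Set
  InSubtree u w = legOf w ≡ legOf u × depth u ≤ depth w

  parent-step : ∀ u w → 1 ≤ depth u →
                (InSubtree u w × dist (parent u) w ≡ suc (dist u w))
              ⊎ (¬ InSubtree u w × dist u w ≡ suc (dist (parent u) w))
  parent-step u w 1≤depth
    rewrite dist≡legDist u w | dist-parent u w
    with depth u | legDist-cases (legOf u) (legOf w) (depth u) (depth w)
       | legDist-cases (legOf u) (legOf w) (pred (depth u)) (depth w)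
  ... | suc n | inj₁ (same , eq) | inj₁ (_ , eq′) with suc n ≤? depth w
  ...   | yes below = inj₁ ((sym same , below) , trans eq′ (trans (∣n-m∣≡1+∣1+n-m∣ below) (cong suc (sym eq))))
  ...   | no ¬below = inj₂ ((λ sub → ¬below (proj₂ sub)) ,
                           trans eq (trans (∣1+n-m∣≡1+∣n-m∣ (≤-pred (≰⇒> ¬below))) (cong suc (sym eq′))))
  parent-step u w _ | suc n | inj₁ (same , _) | inj₂ (other , _) = ⊥-elim (other same)
  parent-step u w _ | suc n | inj₂ (other , _) | inj₁ (same , _) = ⊥-elim (other same)
  parent-step u w _ | suc n | inj₂ (other , eq) | inj₂ (_ , eq′) =
    inj₂ ((λ sub → other (sym (proj₁ sub))) , trans eq (cong suc (sym eq′)))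

  ∈allV : (v : V) → v ∈ allV
  ∈allV b     = here refl
  ∈allV (x i) = there (∈-++⁺ˡ (∈-map⁺ x (∈-allFin i)))
  ∈allV (y i) = there (∈-++⁺ʳ (map x (allFin a)) (∈-++⁺ˡ (∈-map⁺ y (∈-allFin i))))
  ∈allV (z i) = there (∈-++⁺ʳ (map x (allFin a)) (∈-++⁺ʳ (map y (allFin c)) (∈-map⁺ z (∈-allFin i))))

  dist≤ecc : (v u : V) → dist v u ≤ ecc v
  dist≤ecc v u = go allV (∈allV u)
    where
    go : ∀ ws → u ∈ ws → dist v u ≤ foldr (λ w m → dist v w ⊔ m) 0 ws
    go (w ∷ ws) (here refl) = m≤m⊔n (dist v w) _
    go (w ∷ ws) (there u∈ws) = ≤-trans (go ws u∈ws) (m≤n⊔m (dist v w) _)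

  ∃-vertex? : {P : V → Set} → (∀ v → Dec (P v)) → Dec (∃ P)
  ∃-vertex? P? with any? P? allV
  ... | yes found = yes (satisfied found)
  ... | no ¬found = no λ (v , pv) → ¬found (Any.map (λ { refl → pv }) (∈allV v))

  _≟V_ : (u v : V) → Dec (u ≡ v)
  u ≟V v with depth u ≟ depth v | legOf u ≟Leg legOf v | depth u ≟ 0
  ... | no depth≢ | _         | _      = no λ { refl → depth≢ refl }
  ... | yes depth≡ | yes leg≡ | _      = yes (vertex-ext u v depth≡ (inj₂ leg≡))
  ... | yes depth≡ | no _     | yes u₀ = yes (vertex-ext u v depth≡ (inj₁ u₀))
  ... | yes _      | no leg≢  | no _   = no λ { refl → leg≢ refl }

  leaf : (L : Leg) → 1 ≤ legLength L → V
  leaf L 1≤len = vertex L (fromℕ< (m≤pred[n]⇒suc[m]≤n ⦃ >-nonZero 1≤len ⦄ ≤-refl))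

  legOf-leaf : ∀ L 1≤len → legOf (leaf L 1≤len) ≡ L
  legOf-leaf L 1≤len = legOf-vertex L _

  depth-leaf : ∀ L 1≤len → depth (leaf L 1≤len) ≡ legLength L
  depth-leaf L 1≤len =
    trans (depth-vertex L _) (trans (cong suc (toℕ-fromℕ< _)) (suc-pred (legLength L) ⦃ >-nonZero 1≤len ⦄))

  1≤ecc : Fin d → (u : V) → 1 ≤ ecc u
  1≤ecc i b     = ≤-trans (s≤s z≤n) (dist≤ecc b (z i))
  1≤ecc _ (x i) = ≤-trans (s≤s z≤n) (dist≤ecc (x i) b)
  1≤ecc _ (y i) = ≤-trans (s≤s z≤n) (dist≤ecc (y i) b)
  1≤ecc _ (z i) = ≤-trans (s≤s z≤n) (dist≤ecc (z i) b)

module _ {a c d : ℕ} (f : Vtx a c d → ℕ) where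

  private
    V : Set
    V = Vtx a c d

  covers? : ∀ u w → Dec (Covers f u w)
  covers? u w = ∃-vertex? λ v → 0 <? f v ×-dec dist u v ≤? f v ×-dec dist w v ≤? f v
                                 ×-dec (dist u v <? f v ⊎-dec dist w v <? f v)

  heard? : ∀ u → Dec (∃ λ q → Hears f q u)
  heard? u = ∃-vertex? λ q → 0 <? f q ×-dec dist u q ≤? f q

  broadcaster-unheard : BnIndependent f → ∀ {q v} → q ≢ v → 0 < f q → 0 < f v → ¬ dist v q ≤ f q
  broadcaster-unheard bnInd {q} {v} q≢v fq>0 fv>0 v∈Nq = <⇒≱ fv>0 (subst (f v ≤_) (dist-refl v) fv≤0)
    where
    fv≤0 : f v ≤ dist v v
    fv≤0 = bnInd v (q , v , q≢v , (fq>0 , v∈Nq) , (fv>0 , subst (_≤ f v) (sym (dist-refl v)) z≤n)) v fv>0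

  raise : V → V → ℕ
  raise v u with u ≟V v
  ... | yes _ = suc (f v)
  ... | no _  = f u

  raise-self : ∀ v → raise v v ≡ suc (f v)
  raise-self v with v ≟V v
  ... | yes _  = refl
  ... | no v≢v = ⊥-elim (v≢v refl)

  raise-other : ∀ {v u} → u ≢ v → raise v u ≡ f u
  raise-other {v} {u} u≢v with u ≟V v
  ... | yes u≡v = ⊥-elim (u≢v u≡v)
  ... | no _    = refl

  f≤raise : ∀ v u → f u ≤ raise v u
  f≤raise v u with u ≟V v
  ... | yes refl = n≤1+n (f u)
  ... | no _     = ≤-refl

  -- Conditions under which f v can be increased by one keeping f bn-independent.
  record Raisable (v : V) : Set where
    field
      boundary-private : ∀ p q → dist p v ≡ f v → q ≢ v → ¬ Hears f q p
      outside-free     : ∀ p q → dist p v ≡ suc (f v) → 0 < f q → f q ≤ dist p q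
      below-ecc        : suc (f v) ≤ ecc v

  module _ (bnInd : BnIndependent f) {v : V} (raisable : Raisable v) where
    open Raisable raisable

    private
      hears-raise⇒hears : ∀ {q} u → q ≢ v → Hears (raise v) q u → Hears f q u
      hears-raise⇒hears u q≢v heard rewrite raise-other q≢v = heard

      another-hearer : ∀ u {v₁ v₂} → v₁ ≢ v₂ → Hears (raise v) v₁ u → Hears (raise v) v₂ u →
                       Σ V λ q → q ≢ v × Hears f q u
      another-hearer u {v₁} {v₂} v₁≢v₂ h₁ h₂ = pick (v₁ ≟V v)
        where
        pick : Dec (v₁ ≡ v) → Σ V λ q → q ≢ v × Hears f q u
        pick (no v₁≢v)  = v₁ , v₁≢v , hears-raise⇒hears u v₁≢v h₁
        pick (yes v₁≡v) = v₂ , v₂≢v , hears-raise⇒hears u v₂≢v h₂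
          where
          v₂≢v : v₂ ≢ v
          v₂≢v v₂≡v = v₁≢v₂ (trans v₁≡v (sym v₂≡v))

      free-under-raise : ∀ u w → suc (f v) ≤ dist u v → (∀ q → 0 < f q → f q ≤ dist u q) →
                     0 < raise v w → raise v w ≤ dist u w
      free-under-raise u w far free rw>0 with w ≟V v
      ... | yes refl = far
      ... | no _     = free w rw>0

    raise-bnIndependent : BnIndependent (raise v)
    raise-bnIndependent u (v₁ , v₂ , v₁≢v₂ , h₁ , h₂) w rw>0
      with <-cmp (dist u v) (f v) | another-hearer u v₁≢v₂ h₁ h₂
    ... | tri< inside _ _ | q , q≢v , hq =
      ⊥-elim (<⇒≱ inside (bnInd u (v , q , (λ v≡q → q≢v (sym v≡q)) , (fv>0 , <⇒≤ inside) , hq) v fv>0))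
      where fv>0 = ≤-trans (s≤s z≤n) inside
    ... | tri≈ _ onBoundary _ | q , q≢v , hq = ⊥-elim (boundary-private u q onBoundary q≢v hq)
    ... | tri> _ _ outside | _ with dist u v ≟ suc (f v)
    ...   | yes justOutside =
      free-under-raise u w (≤-reflexive (sym justOutside)) (λ q → outside-free u q justOutside) rw>0
    ...   | no ¬justOutside =
      free-under-raise u w (<⇒≤ farOutside) (bnInd u (v₁ , v₂ , v₁≢v₂ , f-hears v₁ h₁ , f-hears v₂ h₂)) rw>0
      where
      farOutside : suc (f v) < dist u v
      farOutside = ≤∧≢⇒< outside (λ eq → ¬justOutside (sym eq))
      f-hears : ∀ q → Hears (raise v) q u → Hears f q u
      f-hears q hq = hears-raise⇒hears u q≢v hq
        where
        q≢v : q ≢ v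
        q≢v refl = <⇒≱ farOutside (subst (dist u v ≤_) (raise-self v) (proj₂ hq))

  maximal⇒¬raisable : MaximalBnIndependent f → ∀ {v} → ¬ Raisable v
  maximal⇒¬raisable ((isBroadcast , bnInd) , maximal) {v} raisable =
    1+n≢n (trans (sym (raise-self v))
                 (maximal (raise v) (raise-isBroadcast , raise-bnIndependent bnInd raisable) (f≤raise v) v))
    where
    raise-isBroadcast : IsBroadcast (raise v)
    raise-isBroadcast u with u ≟V v
    ... | yes refl = Raisable.below-ecc raisable
    ... | no _     = isBroadcast u

  maximal⇒dominating : MaximalBnIndependent f → Fin d → ∀ u → ∃ λ q → Hears f q u
  maximal⇒dominating maximal z₀ u with heard? u
  ... | yes heard = heard
  ... | no unheard = ⊥-elim (maximal⇒¬raisable maximal raisable)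
    where
    fu≡0 : f u ≡ 0
    fu≡0 with f u in eq
    ... | zero  = refl
    ... | suc _ =
      ⊥-elim (unheard (u , subst (0 <_) (sym eq) (s≤s z≤n) , subst (_≤ f u) (sym (dist-refl u)) z≤n))

    raisable : Raisable u
    raisable .Raisable.boundary-private p q p∈B _ hq =
      unheard (q , subst (Hears f q) (dist≡0⇒≡ p u (trans p∈B fu≡0)) hq)
    raisable .Raisable.outside-free p q p∈B fq>0 with f q ≤? dist p q
    ... | yes free = free
    ... | no ¬free = ⊥-elim (unheard (q , fq>0 , (begin
      dist u q              ≤⟨ dist-triangle u p q ⟩
      dist u p + dist p q   ≡⟨ cong (_+ dist p q) (trans (dist-sym u p) (trans p∈B (cong suc fu≡0))) ⟩
      suc (dist p q)        ≤⟨ ≰⇒> ¬free ⟩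
      f q                   ∎)))
      where open ≤-Reasoning
    raisable .Raisable.below-ecc = subst (λ k → suc k ≤ ecc u) (sym fu≡0) (1≤ecc z₀ u)

  -- Claimed edges

  -- An edge e–parent e is claimed by every broadcaster covering it, and, when it is
  -- uncovered, by every broadcaster hearing e.
  Claims : V → V → Set
  Claims v e = 0 < f v × dist e v ≤ f v × (f v < dist (parent e) v → ¬ Covers f e (parent e))

  claims? : ∀ v e → Dec (Claims v e)
  claims? v e = 0 <? f v ×-dec dist e v ≤? f v
                ×-dec (f v <? dist (parent e) v →-dec ¬? (covers? e (parent e)))

  claimCount : Leg → V → ℕ
  claimCount L v = sum (map (λ i → indicator (claims? v (vertex L i))) (allFin (legLength L)))

  weight : V → ℕ
  weight v = claimCount X v + claimCount Y v + 2 * claimCount Z v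

  edge-claimed : (∀ u → ∃ λ q → Hears f q u) → ∀ e → ∃ λ v → Claims v e
  edge-claimed dominating e with covers? e (parent e)
  ... | yes (v , fv>0 , e∈Nv , pe∈Nv , _) = v , fv>0 , e∈Nv , λ pe∉Nv → ⊥-elim (<⇒≱ pe∉Nv pe∈Nv)
  ... | no uncovered with dominating e
  ...   | q , fq>0 , e∈Nq = q , fq>0 , e∈Nq , λ _ → uncovered

  legLength≤claims : (∀ u → ∃ λ q → Hears f q u) → ∀ L → legLength L ≤ sum (map (claimCount L) allV)
  legLength≤claims dominating L = begin
    legLength L                                              ≡⟨ length-tabulate (λ i → i) ⟨
    length edges                                             ≤⟨ length≤sum-map edges claimed ⟩
    sum (map (λ i → sum (map (λ v → claim v i) allV)) edges) ≡⟨ sum-map-swap claim allV edges ⟨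
    sum (map (claimCount L) allV)                            ∎
    where
    open ≤-Reasoning
    edges = allFin (legLength L)
    claim : V → Fin (legLength L) → ℕ
    claim v i = indicator (claims? v (vertex L i))
    claimed : ∀ i → 1 ≤ sum (map (λ v → claim v i) allV)
    claimed i with edge-claimed dominating (vertex L i)
    ... | v , claims = subst (_≤ sum (map (λ v → claim v i) allV))
                             (indicator-yes (claims? v (vertex L i)) claims)
                             (∈⇒≤sum-map (λ v → claim v i) (∈allV v))

  legWeights≤totalWeight : (∀ u → ∃ λ q → Hears f q u) →
                           a + c + 2 * d ≤ sum (map weight allV)
  legWeights≤totalWeight dominating = begin
    a + c + 2 * d
      ≤⟨ +-mono-≤ (+-mono-≤ (claims-of X) (claims-of Y)) (*-monoʳ-≤ 2 (claims-of Z)) ⟩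
    total X + total Y + 2 * total Z
      ≡⟨ cong₂ _+_ (sum-map-+ (claimCount X) (claimCount Y) allV) (sum-map-*ˡ 2 (claimCount Z) allV) ⟨
    sum (map (λ v → claimCount X v + claimCount Y v) allV) + sum (map (λ v → 2 * claimCount Z v) allV)
      ≡⟨ sum-map-+ (λ v → claimCount X v + claimCount Y v) (λ v → 2 * claimCount Z v) allV ⟨
    sum (map weight allV) ∎
    where
    open ≤-Reasoning
    claims-of = legLength≤claims dominating
    total : Leg → ℕ
    total L = sum (map (claimCount L) allV)

  claimCount-window : ∀ L v {lo hi} → 1 ≤ lo →
                      (∀ i → Claims v (vertex L i) → lo ≤ suc (toℕ i) × suc (toℕ i) ≤ hi) →
                      claimCount L v ≤ suc hi ∸ lo
  claimCount-window L v = count-window (λ i → claims? v (vertex L i))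

  claimCount-silent : ∀ L v → f v ≡ 0 → claimCount L v ≤ 0
  claimCount-silent L v fv≡0 = claimCount-window L v ≤-refl
    λ i (fv>0 , _) → ⊥-elim (<-irrefl (sym fv≡0) fv>0)

  claimCount-offLeg : ∀ L v → legOf v ≢ L ⊎ depth v ≡ 0 → claimCount L v ≤ f v ∸ depth v
  claimCount-offLeg L v offLeg = claimCount-window L v ≤-refl
    λ i (_ , heard , _) →
      s≤s z≤n , m+n≤o⇒m≤o∸n (suc (toℕ i)) (subst (_≤ f v) (dist-vertex-otherLeg i offLeg) heard)

  claimCount-onLeg : ∀ L v → legOf v ≡ L → claimCount L v ≤ depth v + f v
  claimCount-onLeg L v onLeg = claimCount-window L v ≤-refl
    λ i (_ , heard , _) → s≤s z≤n , ∣m-n∣≤o⇒m≤n+o _ _ (subst (_≤ f v) (dist-vertex-sameLeg i onLeg) heard)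

  claimCount-onLeg-far : ∀ L v → legOf v ≡ L → f v < depth v → claimCount L v ≤ suc (f v + f v)
  claimCount-onLeg-far L v onLeg far = subst (claimCount L v ≤_) window-size
    (claimCount-window L v (m<n⇒0<n∸m far) λ i (_ , heard , _) →
      let ∣i-v∣≤fv = subst (_≤ f v) (dist-vertex-sameLeg i onLeg) heard
      in ∣m-n∣≤o⇒n∸o≤m _ _ ∣i-v∣≤fv , ∣m-n∣≤o⇒m≤n+o _ _ ∣i-v∣≤fv)
    where
    window-size : suc (depth v + f v) ∸ (depth v ∸ f v) ≡ suc (f v + f v)
    window-size = trans (+-∸-assoc 1 (≤-trans (m∸n≤m (depth v) (f v)) (m≤m+n (depth v) (f v))))
                        (cong suc (t+k∸[t∸k]≡k+k (<⇒≤ far)))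

  claimCount-nearLeaf : ∀ L v → legOf v ≡ L → f v < depth v →
                        claimCount L v ≤ suc (legLength L) ∸ (depth v ∸ f v)
  claimCount-nearLeaf L v onLeg far = claimCount-window L v (m<n⇒0<n∸m far)
    λ i (_ , heard , _) → ∣m-n∣≤o⇒n∸o≤m _ _ (subst (_≤ f v) (dist-vertex-sameLeg i onLeg) heard) , toℕ<n i

  claimCount-gap : ∀ L v → legOf v ≡ L → f v < depth v →
                   (∀ i → suc (toℕ i) ≡ depth v ∸ f v → Covers f (vertex L i) (parent (vertex L i))) →
                   claimCount L v ≤ f v + f v
  claimCount-gap L v onLeg far covered =
    subst (claimCount L v ≤_) (t+k∸[t∸k]≡k+k (<⇒≤ far)) (claimCount-window L v (s≤s z≤n) inWindow)
    where
    inWindow : ∀ i → Claims v (vertex L i) → suc (depth v ∸ f v) ≤ suc (toℕ i) × suc (toℕ i) ≤ depth v + f v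
    inWindow i (_ , heard , uncoveredIfFar) =
      ≤∧≢⇒< (∣m-n∣≤o⇒n∸o≤m _ _ ∣i-v∣≤fv) notLowest , ∣m-n∣≤o⇒m≤n+o _ _ ∣i-v∣≤fv
      where
      ∣i-v∣≤fv = subst (_≤ f v) (dist-vertex-sameLeg i onLeg) heard
      notLowest : depth v ∸ f v ≢ suc (toℕ i)
      notLowest lowest = uncoveredIfFar parentFar (covered i (sym lowest))
        where
        depth≡ : depth v ≡ toℕ i + suc (f v)
        depth≡ = begin
          depth v                  ≡⟨ m∸n+n≡m (<⇒≤ far) ⟨
          depth v ∸ f v + f v      ≡⟨ cong (_+ f v) lowest ⟩
          suc (toℕ i) + f v        ≡⟨ +-suc (toℕ i) (f v) ⟨
          toℕ i + suc (f v)        ∎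
          where open ≡-Reasoning
        parentFar : f v < dist (parent (vertex L i)) v
        parentFar = ≤-reflexive (sym (begin
          dist (parent (vertex L i)) v    ≡⟨ dist-parent-vertex-sameLeg i onLeg ⟩
          ∣ toℕ i - depth v ∣              ≡⟨ cong (∣ toℕ i -_∣) depth≡ ⟩
          ∣ toℕ i - toℕ i + suc (f v) ∣    ≡⟨ ∣m-m+n∣≡n (toℕ i) (suc (f v)) ⟩
          suc (f v)                       ∎))
          where open ≡-Reasoning

  armWeight : Leg → Leg → V → ℕ
  armWeight L M v = claimCount L v + claimCount M v + 2 * claimCount Z v

  module _ {L M : Leg} {v : V} (onL : legOf v ≡ L) (L≢M : L ≢ M) (L≢Z : L ≢ Z) where

    private
      offLeg : ∀ {N} → L ≢ N → claimCount N v ≤ f v ∸ depth v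
      offLeg L≢N = claimCount-offLeg _ v (inj₁ λ v∈N → L≢N (trans (sym onL) v∈N))

    armWeight-near : depth v ≤ f v → armWeight L M v + 2 * depth v ≤ 4 * f v
    armWeight-near near = arm-weight-arith near (claimCount-onLeg L v onL) (offLeg L≢M) (offLeg L≢Z)

    armWeight-far : f v < depth v → armWeight L M v ≤ claimCount L v
    armWeight-far far = begin
      claimCount L v + claimCount M v + 2 * claimCount Z v
        ≤⟨ +-mono-≤ (+-monoʳ-≤ (claimCount L v) (offLeg L≢M)) (*-monoʳ-≤ 2 (offLeg L≢Z)) ⟩
      claimCount L v + (f v ∸ depth v) + 2 * (f v ∸ depth v)
        ≡⟨ cong (λ n → claimCount L v + n + 2 * n) (m≤n⇒m∸n≡0 (<⇒≤ far)) ⟩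
      claimCount L v + 0 + 2 * 0
        ≡⟨ trans (+-identityʳ _) (+-identityʳ _) ⟩
      claimCount L v ∎
      where open ≤-Reasoning

    armWeight≤4f : armWeight L M v ≤ 4 * f v
    armWeight≤4f with f v ≟ 0 | depth v ≤? f v
    ... | yes fv≡0 | _        =
      ≤-trans (+-mono-≤ (+-mono-≤ (silent L) (silent M)) (*-monoʳ-≤ 2 (silent Z))) z≤n
      where silent = λ N → claimCount-silent N v fv≡0
    ... | no _     | yes near = ≤-trans (m≤m+n _ _) (armWeight-near near)
    ... | no fv≢0  | no ¬near = begin
      armWeight L M v    ≤⟨ armWeight-far far ⟩
      claimCount L v     ≤⟨ claimCount-onLeg-far L v onL far ⟩
      suc (f v + f v)    ≤⟨ 1+k+k≤4k (n≢0⇒n>0 fv≢0) ⟩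
      4 * f v            ∎
      where
      open ≤-Reasoning
      far = ≰⇒> ¬near

    armWeight-slack : 1 ≤ depth v → (f v < depth v → claimCount L v + 2 ≤ 4 * f v) →
                      armWeight L M v + 2 ≤ 4 * f v
    armWeight-slack 1≤depth farSlack with depth v ≤? f v
    ... | yes near = ≤-trans (+-monoʳ-≤ (armWeight L M v) (*-monoʳ-≤ 2 1≤depth)) (armWeight-near near)
    ... | no ¬near = ≤-trans (+-monoˡ-≤ 2 (armWeight-far (≰⇒> ¬near))) (farSlack (≰⇒> ¬near))

  weight-z : (∀ j → Covers f (z j) (parent (z j))) → ∀ i → weight (z i) ≤ 4 * f (z i)
  weight-z covered i with suc (toℕ i) ≤? f (z i)
  ... | yes near = z-weight-arith near (offLeg X λ ()) (offLeg Y λ ()) (claimCount-onLeg Z (z i) refl)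
    where offLeg = λ N Z≢N → claimCount-offLeg N (z i) (inj₁ Z≢N)
  ... | no ¬near = begin
    claimCount X (z i) + claimCount Y (z i) + 2 * claimCount Z (z i)
      ≤⟨ +-mono-≤ (+-mono-≤ (offLeg X λ ()) (offLeg Y λ ()))
                  (*-monoʳ-≤ 2 (claimCount-gap Z (z i) refl far (λ j _ → covered j))) ⟩
    (k ∸ t) + (k ∸ t) + 2 * (k + k)
      ≡⟨ cong (λ n → n + n + 2 * (k + k)) (m≤n⇒m∸n≡0 (<⇒≤ far)) ⟩
    2 * (k + k)
      ≡⟨ identity k ⟩
    4 * k ∎
    where
    open ≤-Reasoning
    k = f (z i)
    t = suc (toℕ i)
    far = ≰⇒> ¬near
    offLeg = λ N Z≢N → claimCount-offLeg N (z i) (inj₁ Z≢N)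
    identity : ∀ k → 2 * (k + k) ≡ 4 * k
    identity = solve-∀

  weight-head : weight b ≤ 4 * f b
  weight-head = ≤-trans (m≤m+n _ 0) (arm-weight-arith z≤n (claimCount-onLeg X b refl) (offLeg Y) (offLeg Z))
    where
    offLeg : ∀ N → claimCount N b ≤ f b ∸ 0
    offLeg N = claimCount-offLeg N b (inj₂ refl)

  weight≤4f : (∀ i → Covers f (z i) (parent (z i))) → ∀ v → weight v ≤ 4 * f v
  weight≤4f covered b     = weight-head
  weight≤4f covered (x i) = armWeight≤4f {M = Y} refl (λ ()) (λ ())
  weight≤4f covered (y i) =
    subst (_≤ 4 * f (y i)) (cong (_+ 2 * claimCount Z (y i)) (+-comm (claimCount Y (y i)) _))
          (armWeight≤4f {M = X} refl (λ ()) (λ ()))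
  weight≤4f covered (z i) = weight-z covered i

  -- An uncovered edge on X

  -- A strength-1 vertex q just above a leaf can be raised if the edge between its parent and
  -- grandparent is uncovered: its neighbours are heard by q alone, and a broadcaster hearing
  -- the grandparent strictly would cover that edge.
  module _ (bnInd : BnIndependent f) {q : V} (fq≡1 : f q ≡ 1) (2≤depth : 2 ≤ depth q)
           (nextToLeaf : legLengthOf q ≡ suc (depth q))
           (uncovered : ¬ Covers f (parent q) (parent (parent q))) where

    private
      1≤depth : 1 ≤ depth q
      1≤depth = ≤-trans (s≤s z≤n) 2≤depth

      1≤depth-parent : 1 ≤ depth (parent q)
      1≤depth-parent = subst (1 ≤_) (sym (depth-parent q)) (∸-monoˡ-≤ 1 2≤depth)

      legOf-parent-q : legOf (parent q) ≡ legOf q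
      legOf-parent-q = legOf-parent-deep q 2≤depth

      q-unheard : ∀ {q′} → q′ ≢ q → 0 < f q′ → ¬ dist q q′ ≤ f q′
      q-unheard q′≢q fq′>0 = broadcaster-unheard bnInd q′≢q fq′>0 (subst (0 <_) (sym fq≡1) (s≤s z≤n))

      ¬covers-parentEdge : ∀ {q′} → 0 < f q′ → dist (parent q) q′ ≤ f q′ →
                           ¬ dist (parent (parent q)) q′ < f q′
      ¬covers-parentEdge fq′>0 heard strictlyHeard =
        uncovered (_ , fq′>0 , heard , <⇒≤ strictlyHeard , inj₂ strictlyHeard)

      parent-unheard : ∀ {q′} → q′ ≢ q → ¬ Hears f q′ (parent q)
      parent-unheard {q′} q′≢q (fq′>0 , heard) with parent-step q q′ 1≤depth
      ... | inj₁ (_ , eq) = q-unheard q′≢q fq′>0 (≤-trans (n≤1+n _) (subst (_≤ f q′) eq heard))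
      ... | inj₂ (¬below-q , _) with parent-step (parent q) q′ 1≤depth-parent
      ...   | inj₂ (_ , eq) = ¬covers-parentEdge fq′>0 heard (subst (_≤ f q′) eq heard)
      ...   | inj₁ ((q′∈L , depth≤) , _) =
        q-unheard q′≢q fq′>0 (subst (_≤ f q′) dist≡ (≤-trans (s≤s z≤n) fq′>0))
        where
        q′≡parent : q′ ≡ parent q
        q′≡parent = vertex-ext q′ (parent q) (≤-antisym (≤-pred above-q) depth≤) (inj₂ q′∈L)
          where
          above-q : depth q′ < suc (depth (parent q))
          above-q = subst (depth q′ <_) (trans (sym (suc-pred (depth q) ⦃ >-nonZero 1≤depth ⦄))
                                               (cong suc (sym (depth-parent q))))
                          (≰⇒> λ below → ¬below-q (trans q′∈L legOf-parent-q , below))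
        dist≡ : 1 ≡ dist q q′
        dist≡ = sym (trans (cong (dist q) q′≡parent)
                           (trans (dist-sym q (parent q)) (dist-parent-self q 1≤depth)))

      child-unheard : ∀ {p q′} → legOf p ≡ legOf q → suc (depth q) ≡ depth p → q′ ≢ q → ¬ Hears f q′ p
      child-unheard {p} {q′} p∈L depth-p q′≢q (fq′>0 , heard) =
        q-unheard q′≢q fq′>0 (q-heard (parent-step p q′ (≤-trans (s≤s z≤n) (≤-reflexive depth-p))))
        where
        q≡parent-p : q ≡ parent p
        q≡parent-p = ≡parent q p depth-p (inj₂ (sym p∈L))
        q-heard : (InSubtree p q′ × dist (parent p) q′ ≡ suc (dist p q′))
                ⊎ (¬ InSubtree p q′ × dist p q′ ≡ suc (dist (parent p) q′)) → dist q q′ ≤ f q′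
        q-heard (inj₂ (_ , eq)) =
          subst (λ w → dist w q′ ≤ f q′) (sym q≡parent-p) (≤-trans (n≤1+n _) (subst (_≤ f q′) eq heard))
        q-heard (inj₁ ((q′∈L , depth≤) , _)) = subst (_≤ f q′) (sym dist≡1) fq′>0
          where
          q′≡p : q′ ≡ p
          q′≡p = vertex-ext q′ p (≤-antisym (begin
            depth q′              ≤⟨ depth≤legLength q′ ⟩
            legLengthOf q′        ≡⟨ cong legLength (trans q′∈L p∈L) ⟩
            legLengthOf q         ≡⟨ nextToLeaf ⟩
            suc (depth q)         ≡⟨ depth-p ⟩
            depth p               ∎) depth≤) (inj₂ q′∈L)
            where open ≤-Reasoning
          dist≡1 : dist q q′ ≡ 1
          dist≡1 = trans (cong₂ dist q≡parent-p q′≡p)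
                         (dist-parent-self p (≤-trans (s≤s z≤n) (≤-reflexive depth-p)))

      at-distance-2 : ∀ p → dist p q ≡ 2 → p ≡ parent (parent q)
      at-distance-2 p eq with dist≡⇒ancestor⊎descendant p q 2≤depth eq
      ... | inj₁ (depth≡ , leg) = ≡parent p (parent q)
        (trans (trans (+-comm 1 (depth p)) (cong pred (trans (sym (+-suc (depth p) 1)) depth≡)))
               (sym (depth-parent q)))
        (map₂ (λ p∈L → trans p∈L (sym legOf-parent-q)) leg)
      ... | inj₂ (p∈L , depth≡) = ⊥-elim (<⇒≱ (≤-reflexive (+-comm 2 (depth q))) (begin
        depth q + 2       ≡⟨ depth≡ ⟨
        depth p           ≤⟨ depth≤legLength p ⟩
        legLengthOf p     ≡⟨ cong legLength p∈L ⟩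
        legLengthOf q     ≡⟨ nextToLeaf ⟩
        suc (depth q)     ∎))
        where open ≤-Reasoning

      grandparent-unsaturated : ∀ {q′} → 0 < f q′ → f q′ ≤ dist (parent (parent q)) q′
      grandparent-unsaturated {q′} fq′>0 with f q′ ≤? dist (parent (parent q)) q′
      ... | yes free = free
      ... | no ¬free = ⊥-elim (¬covers-parentEdge fq′>0 parentHeard (≰⇒> ¬free))
        where
        parentHeard : dist (parent q) q′ ≤ f q′
        parentHeard = begin
          dist (parent q) q′
            ≤⟨ dist-triangle (parent q) (parent (parent q)) q′ ⟩
          dist (parent q) (parent (parent q)) + dist (parent (parent q)) q′
            ≡⟨ cong (_+ dist (parent (parent q)) q′)
                    (trans (dist-sym (parent q) _) (dist-parent-self (parent q) 1≤depth-parent)) ⟩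
          suc (dist (parent (parent q)) q′)
            ≤⟨ ≰⇒> ¬free ⟩
          f q′ ∎
          where open ≤-Reasoning

    unit-nextToLeaf-raisable : Raisable q
    unit-nextToLeaf-raisable .Raisable.boundary-private p q′ p∈B q′≢q
      with dist≡⇒ancestor⊎descendant p q 1≤depth (trans p∈B fq≡1)
    ... | inj₁ (depth≡ , leg) = λ heard → parent-unheard q′≢q (subst (Hears f q′) p≡parent heard)
      where
      p≡parent : p ≡ parent q
      p≡parent = ≡parent p q (trans (+-comm 1 (depth p)) depth≡) leg
    ... | inj₂ (p∈L , depth≡) = child-unheard p∈L (sym (trans depth≡ (+-comm (depth q) 1))) q′≢q
    unit-nextToLeaf-raisable .Raisable.outside-free p q′ p∈B fq′>0 =
      subst (λ w → f q′ ≤ dist w q′) (sym (at-distance-2 p (trans p∈B (cong suc fq≡1))))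
            (grandparent-unsaturated fq′>0)
    unit-nextToLeaf-raisable .Raisable.below-ecc = begin
      suc (f q)     ≡⟨ cong suc fq≡1 ⟩
      2             ≤⟨ 2≤depth ⟩
      depth q       ≡⟨ dist-head q ⟨
      dist q b      ≤⟨ dist≤ecc q b ⟩
      ecc q         ∎
      where open ≤-Reasoning

  unit-nextToLeaf⇒parentEdge-covered : MaximalBnIndependent f → ∀ {q} → f q ≡ 1 → 2 ≤ depth q →
                                       legLengthOf q ≡ suc (depth q) → Covers f (parent q) (parent (parent q))
  unit-nextToLeaf⇒parentEdge-covered maximal {q} fq≡1 2≤depth nextToLeaf
    with covers? (parent q) (parent (parent q))
  ... | yes covered  = covered
  ... | no uncovered = ⊥-elim (maximal⇒¬raisable maximal
                                 (unit-nextToLeaf-raisable (proj₂ (proj₁ maximal)) fq≡1 2≤depth nextToLeaf uncovered))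

  offLeg-hearer-covers : ∀ {c₀ ℓ q} → 1 ≤ depth c₀ → depth c₀ ≤ depth ℓ → Hears f q ℓ →
                         legOf q ≢ legOf ℓ ⊎ depth q ≡ 0 → Covers f c₀ (parent c₀)
  offLeg-hearer-covers {c₀} {ℓ} {q} 1≤depth depth≤ (fq>0 , heard) offLeg =
    q , fq>0 , ≤-trans (dist≤depth+depth c₀ q) reach , <⇒≤ parentStrict , inj₂ parentStrict
    where
    open ≤-Reasoning
    reach : depth c₀ + depth q ≤ f q
    reach = begin
      depth c₀ + depth q     ≤⟨ +-monoˡ-≤ (depth q) depth≤ ⟩
      depth ℓ + depth q      ≡⟨ dist-otherLeg ℓ q offLeg ⟨
      dist ℓ q               ≤⟨ heard ⟩
      f q                    ∎
    parentStrict : dist (parent c₀) q < f q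
    parentStrict = begin-strict
      dist (parent c₀) q              ≤⟨ dist≤depth+depth (parent c₀) q ⟩
      depth (parent c₀) + depth q     ≡⟨ cong (_+ depth q) (depth-parent c₀) ⟩
      pred (depth c₀) + depth q
        <⟨ +-monoˡ-< (depth q) (m≤pred[n]⇒suc[m]≤n ⦃ >-nonZero 1≤depth ⦄ ≤-refl) ⟩
      depth c₀ + depth q              ≤⟨ reach ⟩
      f q                             ∎

  leafHearer-onLeg : ∀ {c₀ ℓ q} → ¬ Covers f c₀ (parent c₀) → 1 ≤ depth c₀ → depth c₀ ≤ depth ℓ →
                     Hears f q ℓ → legOf q ≡ legOf ℓ × 1 ≤ depth q
  leafHearer-onLeg {q = q} uncovered 1≤depth depth≤ heard with legOf q ≟Leg legOf _ | depth q ≟ 0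
  ... | yes onLeg | no ≢0      = onLeg , n≢0⇒n>0 ≢0
  ... | yes _     | yes atHead = ⊥-elim (uncovered (offLeg-hearer-covers 1≤depth depth≤ heard (inj₂ atHead)))
  ... | no offLeg | _          = ⊥-elim (uncovered (offLeg-hearer-covers 1≤depth depth≤ heard (inj₁ offLeg)))

  unit-leafHearer-claims≤2 : MaximalBnIndependent f → ∀ {q ℓ} → f q ≡ 1 → 1 < depth q →
                             legOf ℓ ≡ legOf q → depth ℓ ≡ legLengthOf q → dist ℓ q ≤ 1 →
                             claimCount (legOf q) q ≤ 2
  unit-leafHearer-claims≤2 maximal {q} {ℓ} fq≡1 far ℓ∈L depth-ℓ heard with depth q ≟ legLengthOf q
  ... | yes atLeaf = begin
    claimCount (legOf q) q                        ≤⟨ claimCount-nearLeaf (legOf q) q refl far′ ⟩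
    suc (legLengthOf q) ∸ (depth q ∸ f q)         ≡⟨ cong₂ (λ n k → suc n ∸ (depth q ∸ k)) (sym atLeaf) fq≡1 ⟩
    suc (depth q) ∸ (depth q ∸ 1)                 ≡⟨ cong (_∸ (depth q ∸ 1)) (+-comm 1 (depth q)) ⟩
    depth q + 1 ∸ (depth q ∸ 1)                   ≡⟨ t+k∸[t∸k]≡k+k (<⇒≤ far) ⟩
    2                                             ∎
    where
    open ≤-Reasoning
    far′ = subst (_< depth q) (sym fq≡1) far
  ... | no ¬atLeaf = subst (claimCount (legOf q) q ≤_) (cong₂ _+_ fq≡1 fq≡1)
                       (claimCount-gap (legOf q) q refl far′ parentEdge-covered)
    where
    far′ = subst (_< depth q) (sym fq≡1) far
    nextToLeaf : legLengthOf q ≡ suc (depth q)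
    nextToLeaf = ≤-antisym (begin
      legLengthOf q                           ≤⟨ m≤n+m∸n (legLengthOf q) (depth q) ⟩
      depth q + (legLengthOf q ∸ depth q)     ≤⟨ +-monoʳ-≤ (depth q) (m∸n≤∣m-n∣ (legLengthOf q) (depth q)) ⟩
      depth q + ∣ legLengthOf q - depth q ∣   ≡⟨ cong (λ n → depth q + ∣ n - depth q ∣) depth-ℓ ⟨
      depth q + ∣ depth ℓ - depth q ∣         ≡⟨ cong (depth q +_) (dist-sameLeg ℓ q ℓ∈L) ⟨
      depth q + dist ℓ q                      ≤⟨ +-monoʳ-≤ (depth q) heard ⟩
      depth q + 1                             ≡⟨ +-comm (depth q) 1 ⟩
      suc (depth q)                           ∎)
      (≤∧≢⇒< (depth≤legLength q) ¬atLeaf)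
      where open ≤-Reasoning
    parentEdge-covered : ∀ i → suc (toℕ i) ≡ depth q ∸ f q →
                         Covers f (vertex (legOf q) i) (parent (vertex (legOf q) i))
    parentEdge-covered i depth≡ = subst (λ w → Covers f w (parent w)) (sym vertex≡parent)
      (unit-nextToLeaf⇒parentEdge-covered maximal fq≡1 far nextToLeaf)
      where
      vertex≡parent : vertex (legOf q) i ≡ parent q
      vertex≡parent = vertex-ext (vertex (legOf q) i) (parent q)
        (trans (depth-vertex (legOf q) i)
               (trans depth≡ (trans (cong (depth q ∸_) fq≡1) (sym (depth-parent q)))))
        (inj₂ (trans (legOf-vertex (legOf q) i) (sym (legOf-parent-deep q far))))

  leafHearer-claims+2≤4f : MaximalBnIndependent f → ∀ {q ℓ} → legOf ℓ ≡ legOf q → depth ℓ ≡ legLengthOf q →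
                           Hears f q ℓ → f q < depth q → claimCount (legOf q) q + 2 ≤ 4 * f q
  leafHearer-claims+2≤4f maximal {q} ℓ∈L depth-ℓ (fq>0 , heard) far with f q ≟ 1
  ... | yes fq≡1 = subst (λ k → claimCount (legOf q) q + 2 ≤ 4 * k) (sym fq≡1)
                     (+-monoˡ-≤ 2 (unit-leafHearer-claims≤2 maximal fq≡1 (subst (_< depth q) fq≡1 far) ℓ∈L depth-ℓ
                                    (subst (_ ≤_) fq≡1 heard)))
  ... | no fq≢1  = ≤-trans (+-monoˡ-≤ 2 (claimCount-onLeg-far (legOf q) q refl far))
                           (3+k+k≤4k (≤∧≢⇒< fq>0 (λ 1≡fq → fq≢1 (sym 1≡fq))))

  leafHearer-slack : MaximalBnIndependent f → Fin d → ∀ {L M} c₀ → L ≢ M → L ≢ Z →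
                     ¬ Covers f c₀ (parent c₀) → 1 ≤ depth c₀ → depth c₀ ≤ legLength L →
                     ∃ λ q → legOf q ≡ L × 1 ≤ depth q × armWeight L M q + 2 ≤ 4 * f q
  leafHearer-slack maximal z₀ {L} {M} c₀ L≢M L≢Z uncovered 1≤depth-c₀ depth≤len =
    q , onL , 1≤depth , armWeight-slack onL L≢M L≢Z 1≤depth farSlack
    where
    1≤len = ≤-trans 1≤depth-c₀ depth≤len
    ℓ = leaf L 1≤len
    q = proj₁ (maximal⇒dominating maximal z₀ ℓ)
    heard = proj₂ (maximal⇒dominating maximal z₀ ℓ)
    onLeg = leafHearer-onLeg uncovered 1≤depth-c₀
              (subst (depth c₀ ≤_) (sym (depth-leaf L 1≤len)) depth≤len) heard
    onL : legOf q ≡ L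
    onL = trans (proj₁ onLeg) (legOf-leaf L 1≤len)
    1≤depth = proj₂ onLeg
    farSlack : f q < depth q → claimCount L q + 2 ≤ 4 * f q
    farSlack far = subst (λ N → claimCount N q + 2 ≤ 4 * f q) onL
      (leafHearer-claims+2≤4f maximal (sym (proj₁ onLeg)) (trans (depth-leaf L 1≤len) (cong legLength (sym onL)))
                              heard far)

  totalWeight≤4σ : (∀ i → Covers f (z i) (parent (z i))) → sum (map weight allV) ≤ 4 * σ f
  totalWeight≤4σ covered = ≤-trans (sum-map-mono allV (weight≤4f covered)) (≤-reflexive (sum-map-*ˡ 4 f allV))

  totalWeight+4≤4σ : (∀ i → Covers f (z i) (parent (z i))) → ∀ q₁ q₂ →
                     legOf q₁ ≡ X → 1 ≤ depth q₁ → legOf q₂ ≡ Y →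
                     armWeight X Y q₁ + 2 ≤ 4 * f q₁ → armWeight Y X q₂ + 2 ≤ 4 * f q₂ →
                     sum (map weight allV) + 4 ≤ 4 * σ f
  totalWeight+4≤4σ covered b     _     _ () _
  totalWeight+4≤4σ covered (y _) _     () _ _
  totalWeight+4≤4σ covered (z _) _     () _ _
  totalWeight+4≤4σ covered (x _) b     _ _ ()
  totalWeight+4≤4σ covered (x _) (x _) _ _ ()
  totalWeight+4≤4σ covered (x _) (z _) _ _ ()
  totalWeight+4≤4σ covered (x i) (y j) _ _ _ slack-x slack-y = begin
    weight b + sum (map weight (xs ++ yzs)) + 4
      ≡⟨ cong (λ n → weight b + n + 4) (sum-map-++ weight xs yzs) ⟩
    weight b + (sum (map weight xs) + sum (map weight yzs)) + 4
      ≡⟨ regroup (weight b) (sum (map weight xs)) (sum (map weight yzs)) ⟩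
    weight b + ((sum (map weight xs) + 2) + (sum (map weight yzs) + 2))
      ≤⟨ +-mono-≤ (bound b) (+-mono-≤ (sum-map-mono-+ (∈-map⁺ x (∈-allFin i)) bound slack-x)
                                      (sum-map-mono-+ (∈-++⁺ˡ (∈-map⁺ y (∈-allFin j))) bound slack-y′)) ⟩
    fourF b + (sum (map fourF xs) + sum (map fourF yzs))
      ≡⟨ cong (fourF b +_) (sum-map-++ fourF xs yzs) ⟨
    sum (map fourF allV)
      ≡⟨ sum-map-*ˡ 4 f allV ⟩
    4 * σ f ∎
    where
    open ≤-Reasoning
    fourF : Vtx a c d → ℕ
    fourF v = 4 * f v
    xs = map x (allFin a)
    yzs = map y (allFin c) ++ map z (allFin d)
    bound = weight≤4f covered
    slack-y′ : weight (y j) + 2 ≤ 4 * f (y j)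
    slack-y′ = subst (λ n → n + 2 * claimCount Z (y j) + 2 ≤ 4 * f (y j))
                     (+-comm (claimCount Y (y j)) _) slack-y
    regroup : ∀ w m n → w + (m + n) + 4 ≡ w + ((m + 2) + (n + 2))
    regroup = solve-∀

  spider-bound : MaximalBnIndependent f → Fin d → (∀ i → Covers f (z i) (parent (z i))) →
                 a + c + 2 * d ≤ 4 * σ f
  spider-bound maximal z₀ covered =
    ≤-trans (legWeights≤totalWeight (maximal⇒dominating maximal z₀)) (totalWeight≤4σ covered)

  spider-bound-uncoveredX : MaximalBnIndependent f → Fin d → (∀ i → Covers f (z i) (parent (z i))) → a ≤ c →
                            ∀ i₀ → ¬ Covers f (x i₀) (parent (x i₀)) → a + c + 2 * d + 4 ≤ 4 * σ f
  spider-bound-uncoveredX maximal z₀ covered a≤c i₀ uncovered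
    with leafHearer-slack maximal z₀ {X} {Y} (x i₀) (λ ()) (λ ()) uncovered (s≤s z≤n) (toℕ<n i₀)
       | leafHearer-slack maximal z₀ {Y} {X} (x i₀) (λ ()) (λ ()) uncovered (s≤s z≤n) (≤-trans (toℕ<n i₀) a≤c)
  ... | q₁ , onX , 1≤depth , slack₁ | q₂ , onY , _ , slack₂ =
    ≤-trans (+-monoˡ-≤ 4 (legWeights≤totalWeight (maximal⇒dominating maximal z₀)))
            (totalWeight+4≤4σ covered q₁ q₂ onX 1≤depth onY slack₁ slack₂)

lemma4p4 : (r s : ℕ) → 2 ≤ r → 1 ≤ s → (f : Spider r s → ℕ)
    → IsIbnBroadcast f
    → (∀ i → Covers f (z i) (parent (z i)))
    → (⌈ r + s /2⌉ ≤ σ f)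
    × ((∃ λ i → ¬ Covers f (x i) (parent (x i))) → suc ⌈ r + s /2⌉ ≤ σ f)
lemma4p4 (suc r) (suc s) _ _ f (maximal , _) covered =
    ⌈n/2⌉≤m (≤-trans (≤-reflexive (double r (suc s))) (s≤s (spider-bound f maximal fz covered)))
  -- ⌈ 2 + n /2⌉ reduces to suc ⌈ n /2⌉.
  , λ (i₀ , uncovered) → ⌈n/2⌉≤m (≤-trans (≤-reflexive (double+4 r (suc s)))
      (s≤s (spider-bound-uncoveredX f maximal fz covered (n≤1+n r) i₀ uncovered)))
  where
  double : ∀ r s → 2 * (suc r + s) ≡ suc (r + suc r + 2 * s)
  double = solve-∀
  double+4 : ∀ r s → 2 * (2 + (suc r + s)) ≡ suc (r + suc r + 2 * s + 4)
  double+4 = solve-∀
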